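{- Let $\mathcal{A}$ be any standard integer multiplication algorithm multiplying two integers $A,B$, each represented with $n$ base-$s$ digits, using $P$ processors each equipped with an unbounded local memory. Assume that at the beginning of the execution no processor holds more than $\alpha n/P$ digits of each input integer in its local memory, where $\alpha$ is a constant with respect to $n/P$, and that each message moves up to $B_m$ memory words. Then in every execution some processor sends or receives $\Omega\!\left(\frac{n}{B_m\sqrt{P}}\right)$ messages.
   Context: Integers are written in base $s\ge2$, one digit per memory word; $A=(A[n-1],\dots,A[0])_s$. An algorithm multiplying $n$-digit integers $A,B$ is standard if (i) it directly computes all $n^2$ elementary products $A[i]B[j]$, $0\le i,j\le n-1$; (ii) each digit $C[i]$ of $C=AB$ is computed by summing the elementary products $A[j]B[k]$ with $j+k=i$ through a summation tree using additions and subtractions only, plus any carry; (iii) the internal vertex sets of the summation trees of distinct $C[i]$ are disjoint (computations viewed as computational DAGs). Parallel model: $P$ processors with local (non-shared) memories exchanging point-to-point messages; a processor operates only on values in its local memory; recomputation allowed. -}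

module Defs where

open import Level using (0ℓ)
open import Data.Nat using (ℕ; _≤_; _<_; _+_)
open import Data.Fin using (Fin; toℕ; _≟_)
open import Data.Fin.Subset using (Subset) renaming (_∈_ to _∈ₛ_)
open import Data.List using (List; []; _∷_; _++_; length)
open import Data.List.Membership.Propositional using (_∈_)
open import Data.List.Relation.Unary.All using (All)
open import Data.List.Relation.Unary.Unique.Propositional using (Unique)
open import Data.Product using (Σ; ∃; ∃-syntax; _×_; _,_)
open import Data.Sum using (_⊎_)
open import Data.Bool using (_∨_; if_then_else_)
open import Relation.Nullary using (¬_)
open import Relation.Nullary.Decidable using (⌊_⌋)
open import Relation.Binary.PropositionalEquality using (_≡_)

-- Computational DAGs for multiplying two n-digit integers A, B.
-- Vertices are Fin V, listed in a topological order.

data Op : Set where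
  mul    : Op
  addsub : Op
  other  : Op   -- any other operation (carry handling, mod, div, ...)

data Node (n V : ℕ) : Set where
  inputA : Fin n → Node n V
  inputB : Fin n → Node n V
  op     : Op → List (Fin V) → Node n V

record CDAG (n : ℕ) : Set where
  field
    V       : ℕ
    node    : Fin V → Node n V
    acyclic : ∀ v o ps → node v ≡ op o ps → ∀ u → u ∈ ps → toℕ u < toℕ v
    inA     : Fin n → Fin V
    inB     : Fin n → Fin V
    inA-node   : ∀ i → node (inA i) ≡ inputA i
    inB-node   : ∀ i → node (inB i) ≡ inputB i
    inA-unique : ∀ v i → node v ≡ inputA i → v ≡ inA i
    inB-unique : ∀ v i → node v ≡ inputB i → v ≡ inB i

module _ {n : ℕ} (G : CDAG n) where
  open CDAG G

  data SumTree : Fin V → Set where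
    leaf : (v : Fin V) → SumTree v
    add  : (v u w : Fin V) → node v ≡ op addsub (u ∷ w ∷ []) →
           SumTree u → SumTree w → SumTree v

  leaves : ∀ {v} → SumTree v → List (Fin V)
  leaves (leaf v) = v ∷ []
  leaves (add v u w _ t₁ t₂) = leaves t₁ ++ leaves t₂

  internals : ∀ {v} → SumTree v → List (Fin V)
  internals (leaf v) = []
  internals (add v u w _ t₁ t₂) = v ∷ (internals t₁ ++ internals t₂)

  record Standard : Set where
    field
      prod      : Fin n → Fin n → Fin V
      prod-node : ∀ i j → node (prod i j) ≡ op mul (inA i ∷ inB j ∷ [])
      -- (ii) digit C[c] (0 ≤ c < 2n) is computed through a summation tree
      -- whose leaves comprise all A[j]B[k] with j + k = c, plus any carry
      root      : Fin (n + n) → Fin V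
      tree      : (c : Fin (n + n)) → SumTree (root c)
      tree-uniq : ∀ c → Unique (internals (tree c))
      tree-prod : ∀ c (j k : Fin n) → toℕ j + toℕ k ≡ toℕ c →
                  prod j k ∈ leaves (tree c)
      disjoint  : ∀ c d → ¬ (c ≡ d) → ∀ v →
                  v ∈ internals (tree c) → ¬ (v ∈ internals (tree d))

  data Event (P : ℕ) : Set where
    compute : (p : Fin P) → (v : Fin V) → Event P
    send    : (p q : Fin P) → (vs : List (Fin V)) → Event P

  Mem : ℕ → Set₁
  Mem P = Fin P → Fin V → Set

  step : ∀ {P} → Mem P → Event P → Mem P
  step M (compute p v) q u = M q u ⊎ (q ≡ p × u ≡ v)
  step M (send p q vs) r u = M r u ⊎ (r ≡ q × u ∈ vs)

  Enabled : ∀ {P} → ℕ → Mem P → Event P → Set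
  Enabled Bm M (compute p v) = ∃[ o ] ∃[ ps ] (node v ≡ op o ps × All (M p) ps)
  Enabled Bm M (send p q vs) = length vs ≤ Bm × All (M p) vs

  data Valid {P : ℕ} (Bm : ℕ) : Mem P → List (Event P) → Set₁ where
    done : ∀ {M} → Valid Bm M []
    next : ∀ {M e es} → Enabled Bm M e → Valid Bm (step M e) es →
           Valid Bm M (e ∷ es)

  initMem : ∀ {P} → (holdA holdB : Fin P → Subset n) → Mem P
  initMem holdA holdB p v =
    (∃[ i ] (i ∈ₛ holdA p × v ≡ inA i)) ⊎ (∃[ i ] (i ∈ₛ holdB p × v ≡ inB i))

  Complete : ∀ {P} → List (Event P) → Set
  Complete es = ∀ v o ps → node v ≡ op o ps → ∃[ p ] (compute p v ∈ es)

  msgs : ∀ {P} → Fin P → List (Event P) → ℕ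
  msgs p [] = 0
  msgs p (compute _ _ ∷ es) = msgs p es
  msgs p (send q r _ ∷ es) =
    (if ⌊ p ≟ q ⌋ ∨ ⌊ p ≟ r ⌋ then 1 else 0) + msgs p es

-- Charge each elementary product A[i]·B[j] to one processor that
-- computes it; the n² charges are spread over P processors, so some
-- processor p carries at least n²/P of them.  To compute A[i]·B[j], p must
-- know A[i] and B[j]: input values enter p's memory only initially or by
-- messages.  If p knows a digits of A and b digits of B, it computes at most
-- a·b products (a rectangle), and a, b ≤ h + m where h is p's initial share
-- and m ≤ msgs(p)·Bm the number of words p receives.  So n² ≤ P·(h + m)².
-- Since h·P ≤ 2α·n, for P > (4α)² the initial share cannot pay for this
-- and n² ≤ 4·m²·P, i.e. msgs(p) = Ω(n / (Bm·√P)).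

module Submission where

open import Defs
open import Data.Nat using (ℕ; zero; suc; _+_; _*_; _≤_; _<_; z≤n; s≤s)
open import Data.Nat.Properties
  using ( ≤-refl; ≤-reflexive; ≤-trans; ≤-total; <⇒≱; +-mono-≤; +-monoˡ-≤; +-monoʳ-≤
        ; +-identityʳ; m≤m+n; m≤n+m; *-comm; *-identityʳ; *-distribʳ-+
        ; *-mono-≤; *-monoˡ-≤; *-monoʳ-≤; *-cancelʳ-≤; +-*-semiring; module ≤-Reasoning )
open import Data.Nat.Tactic.RingSolver using (solve-∀)
open import Data.Fin using (Fin; zero; suc; _≟_)
open import Data.Fin.Properties using (suc-injective; 0≢1+n)
open import Data.Fin.Subset using (Subset; ∣_∣; inside; outside) renaming (_∈_ to _∈ₛ_)
open import Data.Fin.Subset.Properties using () renaming (_∈?_ to _∈ₛ?_)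
open import Data.Bool using (if_then_else_; _∨_)
open import Data.Bool.Properties using (∨-zeroʳ)
open import Data.Product using (∃-syntax; _×_; _,_; proj₁; proj₂)
open import Data.Sum using (_⊎_; inj₁; inj₂)
import Data.Sum as Sum
open import Data.List using (List; []; _∷_; _++_; length; allFin)
open import Data.List.Properties using (length-++)
open import Data.List.Membership.Propositional using (_∈_)
open import Data.List.Membership.Propositional.Properties using (∈-allFin; ∈-++⁺ˡ; ∈-++⁺ʳ)
open import Data.List.Relation.Unary.Any using (here; there)
import Data.List.Relation.Unary.Any as Any
import Data.List.Relation.Unary.All as All
open import Data.List.Extrema.Nat using (argmax; f[xs]≤f[argmax])
open import Data.Vec using ([]; _∷_)
open import Function.Base using (id)
open import Function.Definitions using (Injective)
open import Relation.Nullary using (Dec; yes; no; does; ¬_; contradiction)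
open import Relation.Nullary.Decidable using (⌊_⌋; _⊎-dec_; _×-dec_)
open import Relation.Binary.Definitions using (DecidableEquality)
open import Relation.Binary.PropositionalEquality
open import Algebra.Properties.Semiring.Sum +-*-semiring
  using (sum; sum-syntax; ∑-comm; ∑-distrib-+; sum-cong-≗; sum-replicate-zero; *-distribˡ-sum; *-distribʳ-sum)

𝟙 : {A : Set} → Dec A → ℕ
𝟙 a? = if does a? then 1 else 0

𝟙-no : {A : Set} (a? : Dec A) → ¬ A → 𝟙 a? ≡ 0
𝟙-no (yes a) ¬a = contradiction a ¬a
𝟙-no (no _)  _  = refl

𝟙-mono : {A B : Set} → (A → B) → (a? : Dec A) (b? : Dec B) → 𝟙 a? ≤ 𝟙 b?
𝟙-mono f (yes a) (yes _) = ≤-refl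
𝟙-mono f (yes a) (no ¬b) = contradiction (f a) ¬b
𝟙-mono f (no _)  _       = z≤n

𝟙-⊎ : {A B C : Set} → (A → B ⊎ C) →
      (a? : Dec A) (b? : Dec B) (c? : Dec C) → 𝟙 a? ≤ 𝟙 b? + 𝟙 c?
𝟙-⊎ split a? b? c? = ≤-trans (𝟙-mono split a? (b? ⊎-dec c?)) (𝟙-∨ b? c?)
  where
  𝟙-∨ : {B C : Set} (b? : Dec B) (c? : Dec C) → 𝟙 (b? ⊎-dec c?) ≤ 𝟙 b? + 𝟙 c?
  𝟙-∨ (yes _) c? = s≤s z≤n
  𝟙-∨ (no _)  c? = ≤-refl

𝟙-× : {A B : Set} (a? : Dec A) (b? : Dec B) → 𝟙 (a? ×-dec b?) ≡ 𝟙 a? * 𝟙 b?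
𝟙-× (yes _) b? = sym (+-identityʳ (𝟙 b?))
𝟙-× (no _)  b? = refl

∑-mono : ∀ {n} {f g : Fin n → ℕ} → (∀ i → f i ≤ g i) → sum f ≤ sum g
∑-mono {zero}  f≤g = z≤n
∑-mono {suc n} f≤g = +-mono-≤ (f≤g zero) (∑-mono (λ i → f≤g (suc i)))

∑-const : ∀ n c → ∑[ i < n ] c ≡ n * c
∑-const zero    c = refl
∑-const (suc n) c = cong (c +_) (∑-const n c)

∑-zero : ∀ {n} {f : Fin n → ℕ} → (∀ i → f i ≡ 0) → sum f ≡ 0
∑-zero {n} f≡0 = trans (sum-cong-≗ f≡0) (sum-replicate-zero n)

∣S∣≡∑𝟙 : ∀ {n} (S : Subset n) → ∣ S ∣ ≡ ∑[ i < n ] 𝟙 (i ∈ₛ? S)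
∣S∣≡∑𝟙 []            = refl
∣S∣≡∑𝟙 (inside  ∷ S) = cong suc (∣S∣≡∑𝟙 S)
∣S∣≡∑𝟙 (outside ∷ S) = ∣S∣≡∑𝟙 S

∑-𝟙-≟ : ∀ {P} (q : Fin P) → ∑[ p < P ] 𝟙 (q ≟ p) ≡ 1
∑-𝟙-≟ {suc P} zero    = cong suc (sum-replicate-zero P)
∑-𝟙-≟         (suc q) = ∑-𝟙-≟ q

∑-𝟙-unique : ∀ {N} {Q : Fin N → Set} (Q? : ∀ k → Dec (Q k)) →
             (∀ k k′ → Q k → Q k′ → k ≡ k′) → ∑[ k < N ] 𝟙 (Q? k) ≤ 1
∑-𝟙-unique {zero}  Q? unique = z≤n
∑-𝟙-unique {suc N} Q? unique with Q? zero
... | yes Q0 =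
  ≤-reflexive (cong suc (∑-zero λ k → 𝟙-no (Q? (suc k)) (λ Qk → 0≢1+n (unique zero (suc k) Q0 Qk))))
... | no _   = ∑-𝟙-unique (λ k → Q? (suc k)) (λ k k′ Qk Qk′ → suc-injective (unique (suc k) (suc k′) Qk Qk′))

∑∑-rectangle : ∀ {m n} {X : Fin m → Set} {Y : Fin n → Set} {Z : Fin m → Fin n → Set}
  (X? : ∀ i → Dec (X i)) (Y? : ∀ j → Dec (Y j)) (Z? : ∀ i j → Dec (Z i j)) →
  (∀ i j → Z i j → X i × Y j) →
  ∑[ i < m ] ∑[ j < n ] 𝟙 (Z? i j) ≤ (∑[ i < m ] 𝟙 (X? i)) * (∑[ j < n ] 𝟙 (Y? j))
∑∑-rectangle {m} {n} X? Y? Z? Z⇒X×Y = begin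
  ∑[ i < m ] ∑[ j < n ] 𝟙 (Z? i j)
    ≤⟨ ∑-mono (λ i → ∑-mono (λ j → 𝟙-mono (Z⇒X×Y i j) (Z? i j) (X? i ×-dec Y? j))) ⟩
  ∑[ i < m ] ∑[ j < n ] 𝟙 (X? i ×-dec Y? j)
    ≡⟨ sum-cong-≗ (λ i → sum-cong-≗ (λ j → 𝟙-× (X? i) (Y? j))) ⟩
  ∑[ i < m ] ∑[ j < n ] (𝟙 (X? i) * 𝟙 (Y? j))
    ≡⟨ sum-cong-≗ (λ i → *-distribˡ-sum (𝟙 (X? i)) (λ j → 𝟙 (Y? j))) ⟨
  ∑[ i < m ] (𝟙 (X? i) * ∑[ j < n ] 𝟙 (Y? j))
    ≡⟨ *-distribʳ-sum (∑[ j < n ] 𝟙 (Y? j)) (λ i → 𝟙 (X? i)) ⟨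
  (∑[ i < m ] 𝟙 (X? i)) * (∑[ j < n ] 𝟙 (Y? j)) ∎
  where open ≤-Reasoning

averaging : ∀ {P} (f : Fin (suc P) → ℕ) → ∃[ p ] (sum f ≤ suc P * f p)
averaging {P} f = p , bound
  where
  p : Fin (suc P)
  p = argmax f zero (allFin (suc P))

  bound : sum f ≤ suc P * f p
  bound = begin
    sum f                  ≤⟨ ∑-mono (λ q → All.lookup (f[xs]≤f[argmax] {f = f} zero (allFin (suc P))) (∈-allFin q)) ⟩
    ∑[ q < suc P ] f p     ≡⟨ ∑-const (suc P) (f p) ⟩
    suc P * f p            ∎
    where open ≤-Reasoning

module _ {X : Set} (_≟ₓ_ : DecidableEquality X) where
  open import Data.List.Membership.DecPropositional _≟ₓ_ using () renaming (_∈?_ to _∈ₗ?_)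

  ∑-𝟙-∈ : ∀ {N} (h : Fin N → X) → Injective _≡_ _≡_ h → ∀ xs →
           ∑[ k < N ] 𝟙 (h k ∈ₗ? xs) ≤ length xs
  ∑-𝟙-∈ {N} h h-inj [] = ≤-reflexive (∑-zero λ k → 𝟙-no (h k ∈ₗ? []) λ ())
  ∑-𝟙-∈ {N} h h-inj (x ∷ xs) = begin
    ∑[ k < N ] 𝟙 (h k ∈ₗ? x ∷ xs)
      ≤⟨ ∑-mono (λ k → 𝟙-⊎ Any.toSum (h k ∈ₗ? x ∷ xs) (h k ≟ₓ x) (h k ∈ₗ? xs)) ⟩
    ∑[ k < N ] (𝟙 (h k ≟ₓ x) + 𝟙 (h k ∈ₗ? xs))
      ≡⟨ ∑-distrib-+ (λ k → 𝟙 (h k ≟ₓ x)) (λ k → 𝟙 (h k ∈ₗ? xs)) ⟩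
    ∑[ k < N ] 𝟙 (h k ≟ₓ x) + ∑[ k < N ] 𝟙 (h k ∈ₗ? xs)
      ≤⟨ +-mono-≤ (∑-𝟙-unique (λ k → h k ≟ₓ x) (λ k k′ hk≡x hk′≡x → h-inj (trans hk≡x (sym hk′≡x))))
                  (∑-𝟙-∈ h h-inj xs) ⟩
    suc (length xs) ∎
    where open ≤-Reasoning

square-mono : ∀ {x y} → x ≤ y → x * x ≤ y * y
square-mono x≤y = *-mono-≤ x≤y x≤y

share-bound : ∀ c n P h → h * P ≤ c * n → n * n ≤ P * ((h + h) * (h + h)) →
  P * (n * n) ≤ (2 * c) * (2 * c) * (n * n)
share-bound c n P h hP≤cn work = begin
  P * (n * n)                      ≡⟨ *-comm P (n * n) ⟩
  n * n * P                        ≤⟨ *-monoˡ-≤ P work ⟩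
  P * ((h + h) * (h + h)) * P      ≡⟨ regroup-square P h ⟩
  (2 * (h * P)) * (2 * (h * P))    ≤⟨ square-mono (*-monoʳ-≤ 2 hP≤cn) ⟩
  (2 * (c * n)) * (2 * (c * n))    ≡⟨ square-of-product c n ⟩
  (2 * c) * (2 * c) * (n * n)      ∎
  where
  open ≤-Reasoning
  regroup-square : ∀ P h → P * ((h + h) * (h + h)) * P ≡ (2 * (h * P)) * (2 * (h * P))
  regroup-square = solve-∀
  square-of-product : ∀ c n → (2 * (c * n)) * (2 * (c * n)) ≡ (2 * c) * (2 * c) * (n * n)
  square-of-product = solve-∀

-- A processor doing a 1/P share of the
-- n² products needs n² ≤ P·(h + m)², where h is its initial share of the
-- input and m the number of words it receives.
communication-dominates : ∀ c n P h m → (2 * c) * (2 * c) < P → h * P ≤ c * n →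
  n * n ≤ P * ((h + m) * (h + m)) → n * n ≤ 4 * (m * m) * P
communication-dominates c n P h m P-large hP≤cn work with ≤-total h m
... | inj₁ h≤m = begin
  n * n                          ≤⟨ work ⟩
  P * ((h + m) * (h + m))        ≤⟨ *-monoʳ-≤ P (square-mono (+-monoˡ-≤ m h≤m)) ⟩
  P * ((m + m) * (m + m))        ≡⟨ square-of-double P m ⟩
  4 * (m * m) * P                ∎
  where
  open ≤-Reasoning
  square-of-double : ∀ P m → P * ((m + m) * (m + m)) ≡ 4 * (m * m) * P
  square-of-double = solve-∀
communication-dominates c zero    P h m P-large hP≤cn work | inj₂ m≤h = z≤n
communication-dominates c n@(suc _) P h m P-large hP≤cn work | inj₂ m≤h =
  contradiction (*-cancelʳ-≤ P ((2 * c) * (2 * c)) (n * n) (share-bound c n P h hP≤cn work′)) (<⇒≱ P-large)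
  where
  work′ : n * n ≤ P * ((h + h) * (h + h))
  work′ = ≤-trans work (*-monoʳ-≤ P (square-mono (+-monoʳ-≤ h m≤h)))

module Execution {n : ℕ} (G : CDAG n) where
  open CDAG G

  IsInput : Fin V → Set
  IsInput u = ∀ o ps → ¬ node u ≡ op o ps

  module _ {P : ℕ} where

    inbox : Fin P → Event G P → List (Fin V)
    inbox p (compute _ _) = []
    inbox p (send _ r vs) = if ⌊ p ≟ r ⌋ then vs else []

    received : Fin P → List (Event G P) → List (Fin V)
    received p []       = []
    received p (e ∷ es) = inbox p e ++ received p es

    inbox-length : ∀ {Bm} p q r vs → length vs ≤ Bm →
                   length (inbox p (send q r vs)) ≤ (if ⌊ p ≟ q ⌋ ∨ ⌊ p ≟ r ⌋ then 1 else 0) * Bm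
    inbox-length {Bm} p q r vs |vs|≤Bm with p ≟ r
    ... | yes refl rewrite ∨-zeroʳ ⌊ p ≟ q ⌋ = ≤-trans |vs|≤Bm (≤-reflexive (sym (+-identityʳ Bm)))
    ... | no _     = z≤n

    received-length : ∀ {Bm M es} → Valid G Bm M es → ∀ p →
                      length (received p es) ≤ msgs G p es * Bm
    received-length done p = z≤n
    received-length {es = compute _ _ ∷ es} (next _ valid) p = received-length valid p
    received-length {Bm} {es = send q r vs ∷ es} (next (|vs|≤Bm , _) valid) p = begin
      length (inbox p (send q r vs) ++ received p es)
        ≡⟨ length-++ (inbox p (send q r vs)) ⟩
      length (inbox p (send q r vs)) + length (received p es)
        ≤⟨ +-mono-≤ (inbox-length p q r vs |vs|≤Bm) (received-length valid p) ⟩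
      involved * Bm + msgs G p es * Bm
        ≡⟨ *-distribʳ-+ Bm involved (msgs G p es) ⟨
      (involved + msgs G p es) * Bm ∎
      where
      open ≤-Reasoning
      involved : ℕ
      involved = if ⌊ p ≟ q ⌋ ∨ ⌊ p ≟ r ⌋ then 1 else 0

    step-input : ∀ {Bm M e p u} → Enabled G Bm M e → IsInput u →
                 step G M e p u → M p u ⊎ u ∈ inbox p e
    step-input {e = compute _ _} _ _ (inj₁ held) = inj₁ held
    step-input {e = compute _ _} (o , ps , node-u , _) u-input (inj₂ (refl , refl)) =
      contradiction node-u (u-input o ps)
    step-input {e = send _ _ _} _ _ (inj₁ held) = inj₁ held
    step-input {e = send _ _ vs} {p} _ _ (inj₂ (refl , u∈vs)) with p ≟ p
    ... | yes _  = inj₂ u∈vs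
    ... | no p≢p = contradiction refl p≢p

    operand-origin : ∀ {Bm M es p v o ps u} → Valid G Bm M es → compute p v ∈ es →
                     node v ≡ op o ps → u ∈ ps → IsInput u → M p u ⊎ u ∈ received p es
    operand-origin (next (_ , _ , node-v′ , operands-held) _) (here refl) node-v u∈ps _
      with trans (sym node-v′) node-v
    ... | refl = inj₁ (All.lookup operands-held u∈ps)
    operand-origin {es = e ∷ es} {p} (next enabled valid) (there c∈es) node-v u∈ps u-input
      with operand-origin valid c∈es node-v u∈ps u-input
    ... | inj₂ u∈received = inj₂ (∈-++⁺ʳ (inbox p e) u∈received)
    ... | inj₁ held       = Sum.map₂ ∈-++⁺ˡ (step-input enabled u-input held)

module Inputs {n : ℕ} (G : CDAG n) where
  open CDAG G
  open Execution G using (IsInput)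

  inA-injective : Injective _≡_ _≡_ inA
  inA-injective {i} {i′} eq with trans (sym (inA-node i)) (trans (cong node eq) (inA-node i′))
  ... | refl = refl

  inB-injective : Injective _≡_ _≡_ inB
  inB-injective {j} {j′} eq with trans (sym (inB-node j)) (trans (cong node eq) (inB-node j′))
  ... | refl = refl

  inA≢inB : ∀ i j → ¬ inA i ≡ inB j
  inA≢inB i j eq with trans (sym (inA-node i)) (trans (cong node eq) (inB-node j))
  ... | ()

  inA-input : ∀ i → IsInput (inA i)
  inA-input i o ps eq with trans (sym (inA-node i)) eq
  ... | ()

  inB-input : ∀ j → IsInput (inB j)
  inB-input j o ps eq with trans (sym (inB-node j)) eq
  ... | ()

module StandardExecution {n : ℕ} (G : CDAG n) (std : Standard G) {P Bm : ℕ}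
  (holdA holdB : Fin P → Subset n) (es : List (Event G P))
  (valid : Valid G Bm (initMem G holdA holdB) es) (complete : Complete G es) where
  open CDAG G
  open Standard std
  open Inputs G
  open Execution G
  open import Data.List.Membership.DecPropositional (_≟_ {V}) using () renaming (_∈?_ to _∈ₗ?_)

  initial-A : ∀ {p i} → initMem G holdA holdB p (inA i) → i ∈ₛ holdA p
  initial-A {p} (inj₁ (i′ , i′∈holdA , eq)) = subst (_∈ₛ holdA p) (inA-injective (sym eq)) i′∈holdA
  initial-A (inj₂ (j , _ , eq)) = contradiction eq (inA≢inB _ j)

  initial-B : ∀ {p j} → initMem G holdA holdB p (inB j) → j ∈ₛ holdB p
  initial-B {p} (inj₂ (j′ , j′∈holdB , eq)) = subst (_∈ₛ holdB p) (inB-injective (sym eq)) j′∈holdB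
  initial-B (inj₁ (i , _ , eq)) = contradiction (sym eq) (inA≢inB i _)

  owner : Fin n → Fin n → Fin P
  owner i j = proj₁ (complete (prod i j) mul (inA i ∷ inB j ∷ []) (prod-node i j))

  owner-computes : ∀ i j → compute (owner i j) (prod i j) ∈ es
  owner-computes i j = proj₂ (complete (prod i j) mul (inA i ∷ inB j ∷ []) (prod-node i j))

  work : Fin P → ℕ
  work p = ∑[ i < n ] ∑[ j < n ] 𝟙 (owner i j ≟ p)

  total-work : ∑[ p < P ] work p ≡ n * n
  total-work = begin
    ∑[ p < P ] ∑[ i < n ] ∑[ j < n ] 𝟙 (owner i j ≟ p)  ≡⟨ ∑-comm {P} {n} (λ p i → ∑[ j < n ] 𝟙 (owner i j ≟ p)) ⟩
    ∑[ i < n ] ∑[ p < P ] ∑[ j < n ] 𝟙 (owner i j ≟ p)  ≡⟨ sum-cong-≗ {n} (λ i → ∑-comm {P} {n} (λ p j → 𝟙 (owner i j ≟ p))) ⟩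
    ∑[ i < n ] ∑[ j < n ] ∑[ p < P ] 𝟙 (owner i j ≟ p)  ≡⟨ sum-cong-≗ {n} (λ i → sum-cong-≗ {n} (λ j → ∑-𝟙-≟ (owner i j))) ⟩
    ∑[ i < n ] ∑[ j < n ] 1                              ≡⟨ sum-cong-≗ {n} (λ i → ∑-const n 1) ⟩
    ∑[ i < n ] (n * 1)                                   ≡⟨ ∑-const n (n * 1) ⟩
    n * (n * 1)                                          ≡⟨ cong (n *_) (*-identityʳ n) ⟩
    n * n                                                ∎
    where open ≡-Reasoning

  Knows : (Fin n → Fin V) → (Fin P → Subset n) → Fin P → Fin n → Set
  Knows inX hold p i = i ∈ₛ hold p ⊎ inX i ∈ received p es

  knows? : ∀ inX hold p i → Dec (Knows inX hold p i)
  knows? inX hold p i = (i ∈ₛ? hold p) ⊎-dec (inX i ∈ₗ? received p es)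

  known : (Fin n → Fin V) → (Fin P → Subset n) → Fin P → ℕ
  known inX hold p = ∑[ i < n ] 𝟙 (knows? inX hold p i)

  owner-knows : ∀ i j p → owner i j ≡ p → Knows inA holdA p i × Knows inB holdB p j
  owner-knows i j p refl =
    Sum.map₁ initial-A (operand-origin valid (owner-computes i j) (prod-node i j) (here refl) (inA-input i)) ,
    Sum.map₁ initial-B (operand-origin valid (owner-computes i j) (prod-node i j) (there (here refl)) (inB-input j))

  work-rectangle : ∀ p → work p ≤ known inA holdA p * known inB holdB p
  work-rectangle p =
    ∑∑-rectangle (knows? inA holdA p) (knows? inB holdB p) (λ i j → owner i j ≟ p) (λ i j → owner-knows i j p)

  known-bound : ∀ {inX} → Injective _≡_ _≡_ inX → ∀ hold p →
                known inX hold p ≤ ∣ hold p ∣ + msgs G p es * Bm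
  known-bound {inX} inX-injective hold p = begin
    ∑[ i < n ] 𝟙 (knows? inX hold p i)
      ≤⟨ ∑-mono (λ i → 𝟙-⊎ id (knows? inX hold p i) (i ∈ₛ? hold p) (inX i ∈ₗ? received p es)) ⟩
    ∑[ i < n ] (𝟙 (i ∈ₛ? hold p) + 𝟙 (inX i ∈ₗ? received p es))
      ≡⟨ ∑-distrib-+ {n} (λ i → 𝟙 (i ∈ₛ? hold p)) (λ i → 𝟙 (inX i ∈ₗ? received p es)) ⟩
    ∑[ i < n ] 𝟙 (i ∈ₛ? hold p) + ∑[ i < n ] 𝟙 (inX i ∈ₗ? received p es)
      ≤⟨ +-mono-≤ (≤-reflexive (sym (∣S∣≡∑𝟙 (hold p)))) (∑-𝟙-∈ _≟_ inX inX-injective (received p es)) ⟩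
    ∣ hold p ∣ + length (received p es)
      ≤⟨ +-monoʳ-≤ ∣ hold p ∣ (received-length valid p) ⟩
    ∣ hold p ∣ + msgs G p es * Bm ∎
    where open ≤-Reasoning

communication-lower-bound : ∀ {n P Bm} α (G : CDAG n) → Standard G →
  (holdA holdB : Fin P → Subset n) →
  (∀ p → ∣ holdA p ∣ * P ≤ α * n) → (∀ p → ∣ holdB p ∣ * P ≤ α * n) →
  (2 * (α + α)) * (2 * (α + α)) < P →
  (es : List (Event G P)) → Valid G Bm (initMem G holdA holdB) es → Complete G es →
  ∃[ p ] (n * n ≤ 4 * ((msgs G p es * Bm) * (msgs G p es * Bm)) * P)
communication-lower-bound {P = zero} α G std holdA holdB smallA smallB () es valid complete
communication-lower-bound {n} {suc P′} {Bm} α G std holdA holdB smallA smallB P-large es valid complete =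
  p , communication-dominates (α + α) n P h m P-large share busiest
  where
  open StandardExecution G std holdA holdB es valid complete
  open CDAG G using (inA; inB)
  open Inputs G using (inA-injective; inB-injective)
  open ≤-Reasoning
  P : ℕ
  P = suc P′

  p : Fin P
  p = proj₁ (averaging work)
  h m : ℕ
  h = ∣ holdA p ∣ + ∣ holdB p ∣
  m = msgs G p es * Bm

  share : h * P ≤ (α + α) * n
  share = begin
    (∣ holdA p ∣ + ∣ holdB p ∣) * P         ≡⟨ *-distribʳ-+ P ∣ holdA p ∣ ∣ holdB p ∣ ⟩
    ∣ holdA p ∣ * P + ∣ holdB p ∣ * P       ≤⟨ +-mono-≤ (smallA p) (smallB p) ⟩
    α * n + α * n                           ≡⟨ *-distribʳ-+ n α α ⟨
    (α + α) * n                             ∎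

  busiest : n * n ≤ P * ((h + m) * (h + m))
  busiest = begin
    n * n                                       ≡⟨ total-work ⟨
    ∑[ q < P ] work q                           ≤⟨ proj₂ (averaging work) ⟩
    P * work p                                  ≤⟨ *-monoʳ-≤ P (work-rectangle p) ⟩
    P * (known inA holdA p * known inB holdB p) ≤⟨ *-monoʳ-≤ P (*-mono-≤ knownA≤ knownB≤) ⟩
    P * ((h + m) * (h + m))                     ∎
    where
    knownA≤ : known inA holdA p ≤ h + m
    knownA≤ = ≤-trans (known-bound inA-injective holdA p) (+-monoˡ-≤ m (m≤m+n ∣ holdA p ∣ ∣ holdB p ∣))
    knownB≤ : known inB holdB p ≤ h + m
    knownB≤ = ≤-trans (known-bound inB-injective holdB p) (+-monoˡ-≤ m (m≤n+m ∣ holdB p ∣ ∣ holdA p ∣))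

corollary2 : (α : ℕ) → ∃[ k ] ∃[ n₀ ] ∃[ P₀ ]
    ((n P Bm : ℕ) → n₀ ≤ n → P₀ ≤ P → 1 ≤ Bm →
     (G : CDAG n) → Standard G →
     (holdA holdB : Fin P → Subset n) →
     (∀ p → ∣ holdA p ∣ * P ≤ α * n) → (∀ p → ∣ holdB p ∣ * P ≤ α * n) →
     (es : List (Event G P)) → Valid G Bm (initMem G holdA holdB) es → Complete G es →
     ∃[ p ] (n * n ≤ k * ((msgs G p es * Bm) * (msgs G p es * Bm)) * P))
corollary2 α = 4 , 0 , suc ((2 * (α + α)) * (2 * (α + α))) ,
  λ n P Bm _ P-large _ G std holdA holdB smallA smallB →
    communication-lower-bound α G std holdA holdB smallA smallB P-large
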